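{- The set $\mathcal{X}$ is a multiplicative $IP$ set: there is an infinite sequence $(x_n)_{n\in\mathbb{N}}$ of positive integers such that $\prod_{n\in F}x_n\in\mathcal{X}$ for every finite nonempty $F\subset\mathbb{N}$.
   Context: For $n\in\mathbb{N}$ and a prime $p$, $X_{n,p}=\left(n\prod_{q\mid n}q^{ -1}\right)\prod_{q\le p}q$ (products over primes $q$), and $\mathcal{X}=\{X_{n,p}: n\in\mathbb{N},\ p\text{ prime},\ p>n/2\}$. -}

module Defs where

open import Data.Nat using (ℕ; zero; suc; _*_; _<_; _≤_; NonZero; nonZero)
open import Data.Nat.Properties using (m*n≢0)
open import Data.Nat.Divisibility using (_∣_; _∣?_)
open import Data.Nat.DivMod using (_/_)
open import Data.Nat.Primality using (Prime; prime?; prime⇒nonZero)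
open import Data.List using (List; []; _∷_; filter; upTo)
open import Data.Nat.ListAction using (product)
open import Data.Product using (_×_; ∃; ∃-syntax; _,_)
open import Relation.Nullary using (yes; no)
open import Relation.Nullary.Decidable using (_×-dec_)

private
  prodFilter≢0 : ∀ {P : ℕ → Set} (P? : ∀ q → Relation.Nullary.Dec (P q)) →
                 (∀ q → P q → Prime q) → (xs : List ℕ) → NonZero (product (filter P? xs))
  prodFilter≢0 P? pr [] = _
  prodFilter≢0 P? pr (x ∷ xs) with P? x
  ... | yes px = m*n≢0 x (product (filter P? xs)) ⦃ prime⇒nonZero (pr x px) ⦄ ⦃ prodFilter≢0 P? pr xs ⦄
  ... | no _  = prodFilter≢0 P? pr xs

PrimeDiv : ℕ → ℕ → Set
PrimeDiv n q = Prime q × q ∣ n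

-- rad n = ∏_{q prime, q ∣ n} q   (for n ≥ 1 every such q satisfies q ≤ n, so q ∈ upTo (suc n))
rad : ℕ → ℕ
rad n = product (filter (λ q → prime? q ×-dec q ∣? n) (upTo (suc n)))

rad-nonZero : ∀ n → NonZero (rad n)
rad-nonZero n = prodFilter≢0 (λ q → prime? q ×-dec q ∣? n) (λ q pq → Data.Product.proj₁ pq) (upTo (suc n))

primorial : ℕ → ℕ
primorial p = product (filter prime? (upTo (suc p)))

X : ℕ → ℕ → ℕ
X n p = (_/_ n (rad n) ⦃ rad-nonZero n ⦄) * primorial p

-- membership in 𝒳 = { X_{n,p} : n ∈ ℕ (n ≥ 1), p prime, p > n/2 }
-- (p > n/2 is written n < 2 * p to avoid rational division)
In𝒳 : ℕ → Set
In𝒳 x = ∃[ n ] ∃[ p ] (1 ≤ n × Prime p × n < 2 * p × x ≡ X n p)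
  where open import Relation.Binary.PropositionalEquality using (_≡_)

{-# OPTIONS --safe #-}
-- Choose primes 2 = p₀ < p₁ < ⋯ growing so fast that p_{k+1} exceeds p_k# ∏_{j<k} x_j, and
-- put x_k = p_{k+1}#.  A product over a finite F with largest index k is M · p_{k+1}#, where
-- M = ∏_{j ∈ F, j < k} x_j has only prime factors ≤ p_k.  Hence n = M · p_k# has rad n = p_k#,
-- so X_{n, p_{k+1}} = M · p_{k+1}#; and as M ≤ ∏_{j<k} x_j, the choice of p_{k+1} gives n < p_{k+1}.
module Submission where

open import Defs
open import Data.Nat using (ℕ; _<_)
open import Data.Nat.ListAction using (product)
open import Data.List using (List; []; map)
open import Data.List.Relation.Unary.Unique.Propositional using (Unique)
open import Data.Product using (Σ; _×_)
open import Relation.Binary.PropositionalEquality using (_≢_)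

open import Level using (Level)
open import Data.Nat.Base using (zero; suc; _*_; _≤_; _!; NonZero; s≤s; z≤n; >-nonZero⁻¹)
open import Data.Nat.Properties
open import Data.Nat.Divisibility
open import Data.Nat.DivMod using (_/_; m*n/n≡m)
open import Data.Nat.Primality using (Prime; prime?; prime[2]; ¬prime[1]; euclidsLemma; prime⇒nonZero; productOfPrimes≢0)
open import Data.Nat.Primality.Factorisation using (factorise; factorisationHasAllPrimeFactors)
open import Data.Nat.ListAction.Properties using (∈⇒∣product; product-↭; product≢0)
open import Data.List.Base using (_∷_; filter; upTo; downFrom; _++_; [_])
open import Data.List.Properties using (upTo-∷ʳ; filter-++; filter-reject; filter-accept; ++-identityʳ)
open import Data.List.Membership.Propositional using (_∈_; _∉_)
open import Data.List.Membership.Propositional.Properties using (∈-upTo⁺; ∈-upTo⁻; ∈-filter⁺; ∈-filter⁻; ∈-∃++)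
open import Data.List.Membership.DecPropositional _≟_ using (_∈?_)
open import Data.List.Relation.Unary.All as All using (All; []; _∷_)
open import Data.List.Relation.Unary.All.Properties using (all-filter) renaming (map⁺ to All-map⁺)
open import Data.List.Relation.Unary.Any using (Any; here; there)
open import Data.List.Relation.Unary.Any.Properties using (map⁻)
open import Data.List.Relation.Unary.Unique.Propositional.Properties using (Unique[x∷xs]⇒x∉xs)
import Data.List.Relation.Unary.AllPairs as AllPairs
open import Data.List.Relation.Binary.Permutation.Propositional using (_↭_; ↭⇒↭ₛ)
open import Data.List.Relation.Binary.Permutation.Propositional.Properties as ↭ using (shift; All-resp-↭)
import Data.List.Relation.Binary.Permutation.Setoid.Properties as Setoid↭
open import Data.List.Extrema.Nat using (max; ⊥≤max; xs≤max; argmax-sel)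
open import Data.Product using (_,_; proj₁; proj₂; ∃₂; ∃-syntax)
open import Data.Sum using (inj₁; inj₂)
open import Relation.Unary using (Pred; Decidable)
open import Relation.Nullary using (¬_; yes; no; contradiction)
open import Relation.Nullary.Decidable using (_×-dec_)
open import Relation.Binary.PropositionalEquality using (_≡_; refl; sym; trans; cong; subst; setoid; module ≡-Reasoning)

private
  variable
    a ℓ : Level
    A : Set a

m≤n⇒m∣n! : ∀ {m n} → 0 < m → m ≤ n → m ∣ n !
m≤n⇒m∣n! {suc k} _ m≤n = ∣-trans (m∣m*n (k !)) (m≤n⇒m!∣n! m≤n)

prime∤1 : ∀ {q} → Prime q → ¬ q ∣ 1
prime∤1 q-prime q∣1 = ¬prime[1] (subst Prime (∣1⇒≡1 q∣1) q-prime)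

∃-prime∣ : ∀ {n} → 1 < n → ∃[ q ] Prime q × q ∣ n
∃-prime∣ {n@(suc _)} 1<n with factorise n
... | record { factors = [] ; isFactorisation = n≡1 } = contradiction (sym n≡1) (<⇒≢ 1<n)
... | record { factors = q ∷ qs ; isFactorisation = n≡q*Πqs ; factorsPrime = q-prime ∷ _ } =
  q , q-prime , subst (q ∣_) (sym n≡q*Πqs) (m∣m*n (product qs))

∃-prime> : ∀ b → ∃[ q ] Prime q × b < q
∃-prime> b with q , q-prime , q∣b!+1 ← ∃-prime∣ (+-monoˡ-< 1 (>-nonZero⁻¹ (b !) ⦃ b !≢0 ⦄)) | b <? q
... | yes b<q = q , q-prime , b<q
... | no b≮q = contradiction (∣m+n∣m⇒∣n q∣b!+1 q∣b!) (prime∤1 q-prime)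
  where
  q∣b! : q ∣ b !
  q∣b! = m≤n⇒m∣n! (>-nonZero⁻¹ q ⦃ prime⇒nonZero q-prime ⦄) (≮⇒≥ b≮q)

prime∣product⇒any : ∀ {q} → Prime q → ∀ ns → q ∣ product ns → Any (q ∣_) ns
prime∣product⇒any q-prime [] q∣1 = contradiction q∣1 (prime∤1 q-prime)
prime∣product⇒any q-prime (m ∷ ns) q∣m*Πns with euclidsLemma m (product ns) q-prime q∣m*Πns
... | inj₁ q∣m = here q∣m
... | inj₂ q∣Πns = there (prime∣product⇒any q-prime ns q∣Πns)

primorial-nonZero : ∀ m → NonZero (primorial m)
primorial-nonZero m = productOfPrimes≢0 (all-filter prime? (upTo (suc m)))

prime∣primorial⇒≤ : ∀ {q m} → Prime q → q ∣ primorial m → q ≤ m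
prime∣primorial⇒≤ {m = m} q-prime q∣m# = m<1+n⇒m≤n (∈-upTo⁻ (proj₁ (∈-filter⁻ prime? {xs = upTo (suc m)}
  (factorisationHasAllPrimeFactors q-prime q∣m# (all-filter prime? (upTo (suc m)))))))

prime≤⇒∣primorial : ∀ {q m} → Prime q → q ≤ m → q ∣ primorial m
prime≤⇒∣primorial q-prime q≤m = ∈⇒∣product (∈-filter⁺ prime? (∈-upTo⁺ (s≤s q≤m)) q-prime)

prime≤primorial : ∀ {q} → Prime q → q ≤ primorial q
prime≤primorial {q} q-prime = ∣⇒≤ ⦃ primorial-nonZero q ⦄ (prime≤⇒∣primorial q-prime ≤-refl)

filter-cong : ∀ {P Q : Pred A ℓ} (P? : Decidable P) (Q? : Decidable Q) {xs} →
              All (λ y → (P y → Q y) × (Q y → P y)) xs → filter P? xs ≡ filter Q? xs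
filter-cong P? Q? [] = refl
filter-cong P? Q? {y ∷ _} ((P⇒Q , Q⇒P) ∷ P⇔Q) with P? y
... | yes Py = trans (cong (y ∷_) (filter-cong P? Q? P⇔Q)) (sym (filter-accept Q? (P⇒Q Py)))
... | no ¬Py = trans (filter-cong P? Q? P⇔Q) (sym (filter-reject Q? (λ Qy → ¬Py (Q⇒P Qy))))

filter-upTo-bounded : ∀ {P : Pred ℕ ℓ} (P? : Decidable P) {m n} →
                      (∀ {q} → P q → q < m) → m ≤ n → filter P? (upTo n) ≡ filter P? (upTo m)
filter-upTo-bounded P? {n = zero} _ z≤n = refl
filter-upTo-bounded {P = P} P? {m} {suc n} P<m m≤1+n with m≤n⇒m<n∨m≡n m≤1+n
... | inj₂ refl = refl
... | inj₁ m<1+n = begin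
  filter P? (upTo (suc n))             ≡⟨ cong (filter P?) (sym (upTo-∷ʳ n)) ⟩
  filter P? (upTo n ++ [ n ])           ≡⟨ filter-++ P? (upTo n) [ n ] ⟩
  filter P? (upTo n) ++ filter P? [ n ] ≡⟨ cong (filter P? (upTo n) ++_) (filter-reject P? ¬Pn) ⟩
  filter P? (upTo n) ++ []              ≡⟨ ++-identityʳ _ ⟩
  filter P? (upTo n)                    ≡⟨ filter-upTo-bounded P? P<m (m<1+n⇒m≤n m<1+n) ⟩
  filter P? (upTo m)                    ∎
  where
  open ≡-Reasoning
  ¬Pn : ¬ P n
  ¬Pn Pn = <⇒≱ (P<m Pn) (m<1+n⇒m≤n m<1+n)

rad≡primorial : ∀ {n R} → R ≤ n → primorial R ∣ n → (∀ {q} → Prime q → q ∣ n → q ≤ R) →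
                rad n ≡ primorial R
rad≡primorial {n} {R} R≤n R#∣n n-primes≤R = cong product (trans
  (filter-upTo-bounded primeDiv? (λ (q-prime , q∣n) → s≤s (n-primes≤R q-prime q∣n)) (s≤s R≤n))
  (filter-cong primeDiv? prime? {upTo (suc R)} (All.tabulate (λ q∈upTo → proj₁ , λ q-prime →
    q-prime , ∣-trans (prime≤⇒∣primorial q-prime (m<1+n⇒m≤n (∈-upTo⁻ q∈upTo))) R#∣n))))
  where
  primeDiv? : Decidable (PrimeDiv n)
  primeDiv? q = prime? q ×-dec q ∣? n

/-congʳ : ∀ {m n o} .⦃ _ : NonZero n ⦄ .⦃ _ : NonZero o ⦄ → n ≡ o → m / n ≡ m / o
/-congʳ refl = refl

∈⇒↭∷ : ∀ {v : A} {xs} → v ∈ xs → ∃[ ys ] xs ↭ v ∷ ys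
∈⇒↭∷ v∈xs with ys , zs , refl ← ∈-∃++ v∈xs = ys ++ zs , shift _ ys zs

Unique-resp-↭ : ∀ {xs ys : List A} → xs ↭ ys → Unique xs → Unique ys
Unique-resp-↭ {A = A} xs↭ys = Setoid↭.Unique-resp-↭ (setoid A) (↭⇒↭ₛ xs↭ys)

Unique∧∈⇒↭∷ : ∀ {v : A} {xs} → Unique xs → v ∈ xs → ∃[ ys ] xs ↭ v ∷ ys × v ∉ ys × Unique ys
Unique∧∈⇒↭∷ xs-unique v∈xs with ys , xs↭v∷ys ← ∈⇒↭∷ v∈xs | Unique-resp-↭ xs↭v∷ys xs-unique
... | v∷ys-unique = ys , xs↭v∷ys , Unique[x∷xs]⇒x∉xs v∷ys-unique , AllPairs.tail v∷ys-unique

All<1+n∧∉⇒All<n : ∀ {n xs} → All (_< suc n) xs → n ∉ xs → All (_< n) xs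
All<1+n∧∉⇒All<n xs<1+n n∉xs = All.tabulate λ {m} m∈xs →
  ≤∧≢⇒< (m<1+n⇒m≤n (All.lookup xs<1+n m∈xs)) (λ { refl → n∉xs m∈xs })

product-map-≤-downFrom : ∀ (f : ℕ → ℕ) → (∀ i → NonZero (f i)) → ∀ k {F} →
                         Unique F → All (_< k) F → product (map f F) ≤ product (map f (downFrom k))
product-map-≤-downFrom f f≢0 zero _ [] = ≤-refl
product-map-≤-downFrom f f≢0 (suc k) {F} F-unique F<1+k with k ∈? F
... | no k∉F = m≤n⇒m≤o*n (f k) ⦃ f≢0 k ⦄
      (product-map-≤-downFrom f f≢0 k F-unique (All<1+n∧∉⇒All<n F<1+k k∉F))
... | yes k∈F with F′ , F↭k∷F′ , k∉F′ , F′-unique ← Unique∧∈⇒↭∷ F-unique k∈F = begin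
  product (map f F)                  ≡⟨ product-↭ (↭.map⁺ f F↭k∷F′) ⟩
  f k * product (map f F′)           ≤⟨ *-monoʳ-≤ (f k) (product-map-≤-downFrom f f≢0 k F′-unique F′<k) ⟩
  f k * product (map f (downFrom k)) ∎
  where
  open ≤-Reasoning
  F′<k : All (_< k) F′
  F′<k = All<1+n∧∉⇒All<n (All.tail (All-resp-↭ F↭k∷F′ F<1+k)) k∉F′

max∈ : ∀ m ns → max m ns ∈ m ∷ ns
max∈ m ns with argmax-sel (λ n → n) m ns
... | inj₁ max≡m  = here max≡m
... | inj₂ max∈ns = there max∈ns

Unique⇒↭max∷ : ∀ m ns → Unique (m ∷ ns) → ∃₂ λ k ks → m ∷ ns ↭ k ∷ ks × Unique ks × All (_< k) ks
Unique⇒↭max∷ m ns m∷ns-unique with ks , ↭k∷ks , k∉ks , ks-unique ← Unique∧∈⇒↭∷ m∷ns-unique (max∈ m ns) =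
  max m ns , ks , ↭k∷ks , ks-unique ,
  All<1+n∧∉⇒All<n (All.map s≤s (All.tail (All-resp-↭ ↭k∷ks (⊥≤max m ns ∷ xs≤max m ns)))) k∉ks

mutual
  p : ℕ → ℕ
  p zero    = 2
  p (suc k) = proj₁ (∃-prime> (D k * primorial (p k)))

  D : ℕ → ℕ
  D zero    = 1
  D (suc k) = primorial (p (suc k)) * D k

x : ℕ → ℕ
x k = primorial (p (suc k))

D≡∏x : ∀ k → D k ≡ product (map x (downFrom k))
D≡∏x zero    = refl
D≡∏x (suc k) = cong (x k *_) (D≡∏x k)

p-prime : ∀ k → Prime (p k)
p-prime zero    = prime[2]
p-prime (suc k) = proj₁ (proj₂ (∃-prime> (D k * primorial (p k))))

D*p#<p : ∀ k → D k * primorial (p k) < p (suc k)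
D*p#<p k = proj₂ (proj₂ (∃-prime> (D k * primorial (p k))))

x-nonZero : ∀ k → NonZero (x k)
x-nonZero k = primorial-nonZero (p (suc k))

D-nonZero : ∀ k → NonZero (D k)
D-nonZero zero    = _
D-nonZero (suc k) = m*n≢0 (x k) (D k) ⦃ x-nonZero k ⦄ ⦃ D-nonZero k ⦄

p<p-suc : ∀ k → p k < p (suc k)
p<p-suc k = ≤-<-trans (≤-trans (prime≤primorial (p-prime k)) (m≤n*m _ (D k) ⦃ D-nonZero k ⦄)) (D*p#<p k)

p-mono-≤ : ∀ {j k} → j ≤ k → p j ≤ p k
p-mono-≤ {k = zero}  z≤n    = ≤-refl
p-mono-≤ {k = suc k} j≤1+k with m≤n⇒m<n∨m≡n j≤1+k
... | inj₁ j<1+k = ≤-trans (p-mono-≤ (m<1+n⇒m≤n j<1+k)) (<⇒≤ (p<p-suc k))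
... | inj₂ refl  = ≤-refl

prime∣∏x⇒≤ : ∀ {k q F} → All (_< k) F → Prime q → q ∣ product (map x F) → q ≤ p k
prime∣∏x⇒≤ {F = F} F<k q-prime q∣∏x = All.lookupWith
  (λ j<k q∣xj → ≤-trans (prime∣primorial⇒≤ q-prime q∣xj) (p-mono-≤ j<k))
  F<k (map⁻ (prime∣product⇒any q-prime (map x F) q∣∏x))

∏x-nonZero : ∀ F → NonZero (product (map x F))
∏x-nonZero F = product≢0 (All-map⁺ (All.universal x-nonZero F))

∏x≤D : ∀ {k F} → Unique F → All (_< k) F → product (map x F) ≤ D k
∏x≤D {k} {F} F-unique F<k =
  subst (product (map x F) ≤_) (sym (D≡∏x k)) (product-map-≤-downFrom x x-nonZero k F-unique F<k)

M*x∈𝒳 : ∀ k {M} .⦃ _ : NonZero M ⦄ → M ≤ D k → (∀ {q} → Prime q → q ∣ M → q ≤ p k) → In𝒳 (M * x k)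
M*x∈𝒳 k {M} M≤D M-primes≤pₖ =
  n , p (suc k) , >-nonZero⁻¹ n , p-prime (suc k) , n<2p , cong (_* x k) (sym n/rad[n]≡M)
  where
  n : ℕ
  n = M * primorial (p k)
  instance
    pₖ#-nonZero : NonZero (primorial (p k))
    pₖ#-nonZero = primorial-nonZero (p k)
    n-nonZero : NonZero n
    n-nonZero = m*n≢0 M (primorial (p k))
  n-primes≤pₖ : ∀ {q} → Prime q → q ∣ n → q ≤ p k
  n-primes≤pₖ q-prime q∣n with euclidsLemma M (primorial (p k)) q-prime q∣n
  ... | inj₁ q∣M  = M-primes≤pₖ q-prime q∣M
  ... | inj₂ q∣pₖ# = prime∣primorial⇒≤ q-prime q∣pₖ#
  rad[n]≡pₖ# : rad n ≡ primorial (p k)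
  rad[n]≡pₖ# = rad≡primorial (∣⇒≤ (∣-trans (prime≤⇒∣primorial (p-prime k) ≤-refl) (n∣m*n M)))
                 (n∣m*n M) n-primes≤pₖ
  n/rad[n]≡M : (n / rad n) ⦃ rad-nonZero n ⦄ ≡ M
  n/rad[n]≡M = trans (/-congʳ ⦃ rad-nonZero n ⦄ rad[n]≡pₖ#) (m*n/n≡m M (primorial (p k)))
  n<2p : n < 2 * p (suc k)
  n<2p = <-≤-trans (≤-<-trans (*-monoˡ-≤ (primorial (p k)) M≤D) (D*p#<p k)) (m≤m+n _ _)

proposition13 : Σ (ℕ → ℕ) (λ x → ((n : ℕ) → 0 < x n) × ((F : List ℕ) → Unique F → F ≢ [] → In𝒳 (product (map x F))))
proposition13 = x , (λ k → >-nonZero⁻¹ (x k) ⦃ x-nonZero k ⦄) , ∏x∈𝒳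
  where
  ∏x∈𝒳 : ∀ F → Unique F → F ≢ [] → In𝒳 (product (map x F))
  ∏x∈𝒳 []      _ []≢[] = contradiction refl []≢[]
  ∏x∈𝒳 (m ∷ ns) F-unique _ with k , ks , F↭k∷ks , ks-unique , ks<k ← Unique⇒↭max∷ m ns F-unique =
    subst In𝒳 (trans (*-comm _ (x k)) (sym (product-↭ (↭.map⁺ x F↭k∷ks))))
      (M*x∈𝒳 k ⦃ ∏x-nonZero ks ⦄ (∏x≤D ks-unique ks<k) (prime∣∏x⇒≤ ks<k))
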